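{- For all containers $F,G$ there are equivalences of containers (1) $\partial(F+G)\simeq\partial F+\partial G$ (sum rule) and (2) $\partial(F\times G)\simeq(\partial F\times G)+(F\times\partial G)$ (Leibniz rule).
   Context: Work in Homotopy Type Theory with a univalent universe. A point $a:A$ is isolated if $a=b$ is decidable for all $b:A$; $A^{\circ}$ is the subtype of isolated points and $A\setminus a:=\sum_{b:A}\neg(a=b)$. A container $(S\triangleleft P)$ has shapes $S:\mathsf{Type}$ and positions $P:S\to\mathsf{Type}$. A cartesian morphism $(S\triangleleft P)\multimap(T\triangleleft Q)$ is $(f,u)$ with $f:S\to T$, $u:\prod_sQ_{fs}\simeq P_s$; an equivalence of containers is one whose shape map $f$ is an equivalence. Sum: $(S\triangleleft P)+(T\triangleleft Q):=(S+T\triangleleft[P,Q])$; product: $(S\triangleleft P)\times(T\triangleleft Q):=(S\times T\triangleleft\lambda(s,t).P_s+Q_t)$; derivative: $\partial(S\triangleleft P):=((s,p):\sum_s(P_s)^{\circ}\triangleleft P_s\setminus p)$. -}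

module Defs where

open import Level using (Level; suc)
open import Data.Product using (Σ; _×_; _,_)
open import Data.Sum using (_⊎_; [_,_])
open import Relation.Nullary using (¬_; Dec)
open import Relation.Binary.PropositionalEquality using (_≡_)
open import Function.Bundles using (_↔_)

record Container (ℓ : Level) : Set (suc ℓ) where
  constructor _◁_
  field
    Shape : Set ℓ
    Pos   : Shape → Set ℓ
open Container public

isIsolated : ∀ {ℓ} {A : Set ℓ} → A → Set ℓ
isIsolated {A = A} a = (b : A) → Dec (a ≡ b)

_° : ∀ {ℓ} → Set ℓ → Set ℓ
A ° = Σ A isIsolated

_∖_ : ∀ {ℓ} (A : Set ℓ) → A → Set ℓ
A ∖ a = Σ A (λ b → ¬ (a ≡ b))

-- f is an equivalence (stated via a two-sided inverse; logically equivalent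
-- to being a (coherent) equivalence)
IsEquiv : ∀ {ℓ} {A B : Set ℓ} → (A → B) → Set ℓ
IsEquiv {A = A} {B} f =
  Σ (B → A) (λ g → ((x : A) → g (f x) ≡ x) × ((y : B) → f (g y) ≡ y))

record _⊸_ {ℓ} (F G : Container ℓ) : Set ℓ where
  field
    shapeMap : Shape F → Shape G
    posEquiv : (s : Shape F) → Pos G (shapeMap s) ↔ Pos F s
open _⊸_ public

_≃ᶜ_ : ∀ {ℓ} → Container ℓ → Container ℓ → Set ℓ
F ≃ᶜ G = Σ (F ⊸ G) (λ m → IsEquiv (shapeMap m))

_+ᶜ_ : ∀ {ℓ} → Container ℓ → Container ℓ → Container ℓ
(S ◁ P) +ᶜ (T ◁ Q) = (S ⊎ T) ◁ [ P , Q ]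

_×ᶜ_ : ∀ {ℓ} → Container ℓ → Container ℓ → Container ℓ
(S ◁ P) ×ᶜ (T ◁ Q) = (S × T) ◁ (λ { (s , t) → P s ⊎ Q t })

∂ : ∀ {ℓ} → Container ℓ → Container ℓ
∂ (S ◁ P) = (Σ S (λ s → P s °)) ◁ (λ { (s , (p , _)) → P s ∖ p })

infixr 5 _+ᶜ_
infixr 6 _×ᶜ_

-- An isolated position of P s ⊎ Q t is the same thing as an isolated position of
-- one summand: equality between different summands is decidable (it never holds)
-- and equality within a summand is equality of the underlying positions.
-- Removing such a position from P s ⊎ Q t removes it from its summand and leaves
-- the other one intact, which is the Leibniz rule; the sum rule is a mere
-- regrouping of shapes. Extensionality is needed only to compare isolation
-- witnesses, which are functions.
module Submission where

open import Defs
open import Level using (Level)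
open import Data.Product using (Σ; _×_; _,_)
open import Data.Sum using (_⊎_; inj₁; inj₂)
open import Data.Sum.Properties using (inj₁-injective; inj₂-injective)
open import Relation.Nullary using (Dec; yes; no)
open import Relation.Nullary.Decidable using (map′; dec-no)
open import Relation.Binary.PropositionalEquality using (_≡_; refl; sym; trans; cong)
open import Function.Bundles using (_↔_; mk↔ₛ′; Inverse)
open import Function.Properties.Inverse using (↔-refl)
open import Function.Related.TypeIsomorphisms using (Σ-distribʳ-⊎)
open import Axiom.Extensionality.Propositional using (Extensionality)

open Inverse using (to; from; strictlyInverseˡ; strictlyInverseʳ)

private
  variable
    ℓ : Level
    A B : Set ℓ

↔⇒IsEquiv : (e : A ↔ B) → IsEquiv (to e)
↔⇒IsEquiv e = from e , strictlyInverseʳ e , strictlyInverseˡ e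

mk≃ᶜ : {F G : Container ℓ} (e : Shape F ↔ Shape G) →
       ((s : Shape F) → Pos G (to e s) ↔ Pos F s) → F ≃ᶜ G
mk≃ᶜ e u = record { shapeMap = to e ; posEquiv = u } , ↔⇒IsEquiv e

∂-+ : (F G : Container ℓ) → ∂ (F +ᶜ G) ≃ᶜ (∂ F +ᶜ ∂ G)
∂-+ F G = mk≃ᶜ Σ-distribʳ-⊎ λ { (inj₁ _ , _) → ↔-refl ; (inj₂ _ , _) → ↔-refl }

-- The `no` cases of the inverse laws here and below hold by refl: the standard
-- library's ⊥ is a record with an irrelevant field, so any two proofs of ¬ A are
-- definitionally equal.
Dec-cong : A ↔ B → Dec A ↔ Dec B
Dec-cong e = mk↔ₛ′ (map′ (to e) (from e)) (map′ (from e) (to e)) toFrom fromTo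
  where
  toFrom : ∀ b? → map′ (to e) (from e) (map′ (from e) (to e) b?) ≡ b?
  toFrom (yes b) = cong yes (strictlyInverseˡ e b)
  toFrom (no _)  = refl
  fromTo : ∀ a? → map′ (from e) (to e) (map′ (to e) (from e) a?) ≡ a?
  fromTo (yes a) = cong yes (strictlyInverseʳ e a)
  fromTo (no _)  = refl

inj₁-≡↔ : {x y : A} → (inj₁ {B = B} x ≡ inj₁ y) ↔ (x ≡ y)
inj₁-≡↔ = mk↔ₛ′ inj₁-injective (cong inj₁) (λ { refl → refl }) (λ { refl → refl })

inj₂-≡↔ : {x y : B} → (inj₂ {A = A} x ≡ inj₂ y) ↔ (x ≡ y)
inj₂-≡↔ = mk↔ₛ′ inj₂-injective (cong inj₂) (λ { refl → refl }) (λ { refl → refl })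

module _ {A B : Set ℓ} where

  ∖-inj₁ : (p : A) → ((A ∖ p) ⊎ B) ↔ ((A ⊎ B) ∖ inj₁ p)
  ∖-inj₁ p = mk↔ₛ′ embed split (λ { (inj₁ _ , _) → refl ; (inj₂ _ , _) → refl })
                               (λ { (inj₁ _) → refl ; (inj₂ _) → refl })
    where
    embed : (A ∖ p) ⊎ B → (A ⊎ B) ∖ inj₁ p
    embed (inj₁ (a , p≢a)) = inj₁ a , λ e → p≢a (inj₁-injective e)
    embed (inj₂ b)         = inj₂ b , λ ()
    split : (A ⊎ B) ∖ inj₁ p → (A ∖ p) ⊎ B
    split (inj₁ a , p≢a) = inj₁ (a , λ e → p≢a (cong inj₁ e))
    split (inj₂ b , _)   = inj₂ b

  ∖-inj₂ : (p : B) → (A ⊎ (B ∖ p)) ↔ ((A ⊎ B) ∖ inj₂ p)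
  ∖-inj₂ p = mk↔ₛ′ embed split (λ { (inj₁ _ , _) → refl ; (inj₂ _ , _) → refl })
                               (λ { (inj₁ _) → refl ; (inj₂ _) → refl })
    where
    embed : A ⊎ (B ∖ p) → (A ⊎ B) ∖ inj₂ p
    embed (inj₁ a)         = inj₁ a , λ ()
    embed (inj₂ (b , p≢b)) = inj₂ b , λ e → p≢b (inj₂-injective e)
    split : (A ⊎ B) ∖ inj₂ p → A ⊎ (B ∖ p)
    split (inj₁ a , _)   = inj₁ a
    split (inj₂ b , p≢b) = inj₂ (b , λ e → p≢b (cong inj₂ e))

module _ (ext : Extensionality ℓ ℓ) where

  isolated-inj₁ : {A B : Set ℓ} {p : A} → isIsolated (inj₁ {B = B} p) ↔ isIsolated p
  isolated-inj₁ {A} {B} = mk↔ₛ′ restrict extend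
    (λ i → ext λ a → strictlyInverseˡ (Dec-cong inj₁-≡↔) (i a))
    (λ i → ext λ { (inj₁ a) → strictlyInverseʳ (Dec-cong inj₁-≡↔) (i (inj₁ a))
                 ; (inj₂ b) → sym (dec-no (i (inj₂ b)) λ ()) })
    where
    restrict : {p : A} → isIsolated (inj₁ {B = B} p) → isIsolated p
    restrict i a = to (Dec-cong inj₁-≡↔) (i (inj₁ a))
    extend : {p : A} → isIsolated p → isIsolated (inj₁ {B = B} p)
    extend i (inj₁ a) = from (Dec-cong inj₁-≡↔) (i a)
    extend i (inj₂ b) = no λ ()

  isolated-inj₂ : {A B : Set ℓ} {p : B} → isIsolated (inj₂ {A = A} p) ↔ isIsolated p
  isolated-inj₂ {A} {B} = mk↔ₛ′ restrict extend
    (λ i → ext λ b → strictlyInverseˡ (Dec-cong inj₂-≡↔) (i b))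
    (λ i → ext λ { (inj₁ a) → sym (dec-no (i (inj₁ a)) λ ())
                 ; (inj₂ b) → strictlyInverseʳ (Dec-cong inj₂-≡↔) (i (inj₂ b)) })
    where
    restrict : {p : B} → isIsolated (inj₂ {A = A} p) → isIsolated p
    restrict i b = to (Dec-cong inj₂-≡↔) (i (inj₂ b))
    extend : {p : B} → isIsolated p → isIsolated (inj₂ {A = A} p)
    extend i (inj₁ a) = no λ ()
    extend i (inj₂ b) = from (Dec-cong inj₂-≡↔) (i b)

  °-⊎ : {A B : Set ℓ} → (A ⊎ B) ° ↔ (A ° ⊎ B °)
  °-⊎ {A} {B} = mk↔ₛ′ split join toFrom fromTo
    where
    split : (A ⊎ B) ° → A ° ⊎ B °
    split (inj₁ a , i) = inj₁ (a , to isolated-inj₁ i)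
    split (inj₂ b , i) = inj₂ (b , to isolated-inj₂ i)
    join : A ° ⊎ B ° → (A ⊎ B) °
    join (inj₁ (a , i)) = inj₁ a , from isolated-inj₁ i
    join (inj₂ (b , i)) = inj₂ b , from isolated-inj₂ i
    toFrom : ∀ x → split (join x) ≡ x
    toFrom (inj₁ (a , i)) = cong (λ i → inj₁ (a , i)) (strictlyInverseˡ isolated-inj₁ i)
    toFrom (inj₂ (b , i)) = cong (λ i → inj₂ (b , i)) (strictlyInverseˡ isolated-inj₂ i)
    fromTo : ∀ x → join (split x) ≡ x
    fromTo (inj₁ a , i) = cong (inj₁ a ,_) (strictlyInverseʳ isolated-inj₁ i)
    fromTo (inj₂ b , i) = cong (inj₂ b ,_) (strictlyInverseʳ isolated-inj₂ i)

  ∂-×-shape : (F G : Container ℓ) →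
              Shape (∂ (F ×ᶜ G)) ↔ Shape ((∂ F ×ᶜ G) +ᶜ (F ×ᶜ ∂ G))
  ∂-×-shape (S ◁ P) (T ◁ Q) =
    mk↔ₛ′ (λ { ((s , t) , x) → distribute s t (to °-⊎ x) }) collect
    (λ { (inj₁ ((s , p) , t)) → cong (distribute s t) (strictlyInverseˡ °-⊎ (inj₁ p))
       ; (inj₂ (s , t , q))   → cong (distribute s t) (strictlyInverseˡ °-⊎ (inj₂ q)) })
    (λ { ((s , t) , x) → trans (collect-distribute s t (to °-⊎ x))
                               (cong ((s , t) ,_) (strictlyInverseʳ °-⊎ x)) })
    where
    distribute : (s : S) (t : T) → P s ° ⊎ Q t ° →
                 (Σ S (λ s → P s °) × T) ⊎ (S × Σ T (λ t → Q t °))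
    distribute s t (inj₁ p) = inj₁ ((s , p) , t)
    distribute s t (inj₂ q) = inj₂ (s , t , q)
    collect : (Σ S (λ s → P s °) × T) ⊎ (S × Σ T (λ t → Q t °)) →
              Σ (S × T) (λ { (s , t) → (P s ⊎ Q t) ° })
    collect (inj₁ ((s , p) , t)) = (s , t) , from °-⊎ (inj₁ p)
    collect (inj₂ (s , t , q))   = (s , t) , from °-⊎ (inj₂ q)
    collect-distribute : ∀ s t y → collect (distribute s t y) ≡ ((s , t) , from °-⊎ y)
    collect-distribute s t (inj₁ _) = refl
    collect-distribute s t (inj₂ _) = refl

  ∂-× : (F G : Container ℓ) → ∂ (F ×ᶜ G) ≃ᶜ ((∂ F ×ᶜ G) +ᶜ (F ×ᶜ ∂ G))
  ∂-× F G = mk≃ᶜ (∂-×-shape F G)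
    λ { (_ , inj₁ p , _) → ∖-inj₁ p ; (_ , inj₂ q , _) → ∖-inj₂ q }

proposition3p14 : {ℓ : Level} → Extensionality ℓ ℓ → (F G : Container ℓ) →
    (∂ (F +ᶜ G) ≃ᶜ (∂ F +ᶜ ∂ G)) × (∂ (F ×ᶜ G) ≃ᶜ ((∂ F ×ᶜ G) +ᶜ (F ×ᶜ ∂ G)))
proposition3p14 ext F G = ∂-+ F G , ∂-× ext F G
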